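{- Let $n\ge2$ be a natural number, let a group $G$ act on a nonempty set $\Omega$, and suppose $\Omega$ is $(n,r)$-paradoxical with respect to this action. Then $r\ge 2n$.
   Context: For $\gamma\in G$ and $E\subseteq\Omega$ write $\gamma(E)=\{\gamma\cdot x:x\in E\}$. For $E,F\subseteq\Omega$ and $r\in\mathbb N$, write $E\sim_r F$ if there are a partition $E=E_0\sqcup\dots\sqcup E_{r-1}$ and elements $\gamma_0,\dots,\gamma_{r-1}\in G$ with $F=\gamma_0(E_0)\sqcup\dots\sqcup\gamma_{r-1}(E_{r-1})$ (a disjoint union). A set $E\subseteq\Omega$ is $(n,r)$-paradoxical with respect to the action if there is a partition $E=P_0\sqcup\dots\sqcup P_{n-1}$ and natural numbers $r_0,\dots,r_{n-1}$ with $P_j\sim_{r_j}E$ for all $j<n$ and $r_0+\dots+r_{n-1}=r$. -}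

module Defs where

open import Level using (0ℓ)
open import Algebra.Bundles using (Group)
open import Data.Nat using (ℕ)
open import Data.Fin using (Fin)
open import Data.List using (tabulate)
open import Data.Nat.ListAction using (sum)
open import Data.Product using (Σ; ∃; _×_)
open import Relation.Unary using (Pred; _⊆_)
open import Relation.Binary.PropositionalEquality using (_≡_)

record Action (G : Group 0ℓ 0ℓ) (Ω : Set) : Set where
  open Group G
  field
    _·_      : Carrier → Ω → Ω
    identity : ∀ x → ε · x ≡ x
    compat   : ∀ g h x → (g ∙ h) · x ≡ g · (h · x)
    resp     : ∀ {g h} → g ≈ h → ∀ x → g · x ≡ h · x

module _ {G : Group 0ℓ 0ℓ} {Ω : Set} (A : Action G Ω) where
  open Group G using (Carrier)
  open Action A

  image : Carrier → Pred Ω 0ℓ → Pred Ω 0ℓ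
  image γ E y = Σ Ω (λ x → E x × γ · x ≡ y)

  -- E = P₀ ⊔ … ⊔ P_{k-1}  (a partition of E into k possibly empty pieces)
  record IsPartition {k : ℕ} (E : Pred Ω 0ℓ) (P : Fin k → Pred Ω 0ℓ) : Set where
    field
      sub      : ∀ i → P i ⊆ E
      cover    : ∀ {x} → E x → Σ (Fin k) (λ i → P i x)
      disjoint : ∀ i j {x} → P i x → P j x → i ≡ j

  Equidecomp : ℕ → Pred Ω 0ℓ → Pred Ω 0ℓ → Set₁
  Equidecomp r E F =
    Σ (Fin r → Pred Ω 0ℓ) λ Es →
    Σ (Fin r → Carrier) λ γs →
      IsPartition E Es × IsPartition F (λ i → image (γs i) (Es i))

  Paradoxical : ℕ → ℕ → Pred Ω 0ℓ → Set₁
  Paradoxical n r E =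
    Σ (Fin n → Pred Ω 0ℓ) λ Ps →
    Σ (Fin n → ℕ) λ rs →
      IsPartition E Ps
      × (∀ j → Equidecomp (rs j) (Ps j) E)
      × sum (tabulate rs) ≡ r

module Submission where

-- If a piece P of the partition satisfies P ∼_r Ω, then r ≥ 1 since Ω is nonempty, and
-- r = 1 would make Ω a translate of P, forcing P = Ω because translations are injective.
-- With n ≥ 2 there is another piece, nonempty and disjoint from P, so every r_j ≥ 2 and
-- r = Σ r_j ≥ 2n.

open import Defs
open import Level using (0ℓ)
open import Algebra.Bundles using (Group)
open import Data.Nat using (ℕ; _≤_; _*_; zero; suc; s≤s; z≤n)
open import Data.Nat.Properties using (+-mono-≤; *-comm)
open import Data.Fin using (Fin; punchIn) renaming (zero to fzero; suc to fsuc)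
open import Data.Fin.Properties using (punchInᵢ≢i)
open import Data.List using (tabulate)
open import Data.Nat.ListAction using (sum)
open import Data.Product using (∃; _,_)
open import Data.Unit using (tt)
open import Data.Empty using (⊥-elim)
open import Relation.Nullary using (¬_)
open import Relation.Unary using (Pred; U)
open import Relation.Binary.PropositionalEquality using (_≡_; sym; cong; subst; subst₂; module ≡-Reasoning)

sum-tabulate-≥ : ∀ n k (rs : Fin n → ℕ) → (∀ j → k ≤ rs j) → n * k ≤ sum (tabulate rs)
sum-tabulate-≥ zero    k rs k≤rs = z≤n
sum-tabulate-≥ (suc n) k rs k≤rs =
  +-mono-≤ (k≤rs fzero) (sum-tabulate-≥ n k (λ j → rs (fsuc j)) (λ j → k≤rs (fsuc j)))

module _ {G : Group 0ℓ 0ℓ} {Ω : Set} (A : Action G Ω) where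
  open Group G using (_∙_; ε; _⁻¹; inverseˡ)
  open Action A
  open IsPartition

  ·-injective : ∀ g {x y} → g · x ≡ g · y → x ≡ y
  ·-injective g {x} {y} gx≡gy = begin
    x                 ≡⟨ sym (identity x) ⟩
    ε · x             ≡⟨ sym (resp (inverseˡ g) x) ⟩
    ((g ⁻¹) ∙ g) · x  ≡⟨ compat _ _ x ⟩
    (g ⁻¹) · (g · x)  ≡⟨ cong ((g ⁻¹) ·_) gx≡gy ⟩
    (g ⁻¹) · (g · y)  ≡⟨ sym (compat _ _ y) ⟩
    ((g ⁻¹) ∙ g) · y  ≡⟨ resp (inverseˡ g) y ⟩
    ε · y             ≡⟨ identity y ⟩
    y                 ∎
    where open ≡-Reasoning

  equidecomp-nonempty : ∀ {r E F x} → Equidecomp A r E F → F x → ∃ E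
  equidecomp-nonempty (Es , γs , partE , partF) Fx with cover partF Fx
  ... | i , x , Esᵢx , _ = x , sub partE i Esᵢx

  equidecomp-0-empty : ∀ {E F x} → Equidecomp A 0 E F → ¬ F x
  equidecomp-0-empty (Es , γs , partE , partF) Fx with cover partF Fx
  ... | () , _

  equidecomp-1-univ : ∀ {E} → Equidecomp A 1 E U → ∀ y → E y
  equidecomp-1-univ {E} (Es , γs , partE , partF) y with cover partF {γs fzero · y} tt
  ... | fzero , x , Esx , γx≡γy = subst E (·-injective (γs fzero) γx≡γy) (sub partE fzero Esx)

  paradoxical-piece-count-≥2 : ∀ {m} {Ps : Fin (suc (suc m)) → Pred Ω 0ℓ} {rs : Fin (suc (suc m)) → ℕ}
    → Ω → IsPartition A U Ps → (∀ j → Equidecomp A (rs j) (Ps j) U) → ∀ j → 2 ≤ rs j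
  paradoxical-piece-count-≥2 {rs = rs} ω partU Ps∼U j with rs j | Ps∼U j
  ... | zero          | Pⱼ∼U = ⊥-elim (equidecomp-0-empty {x = ω} Pⱼ∼U tt)
  ... | suc (suc _)   | _    = s≤s (s≤s z≤n)
  ... | suc zero      | Pⱼ∼U with equidecomp-nonempty {x = ω} (Ps∼U (punchIn j fzero)) tt
  ...   | x , Pₖx = ⊥-elim (punchInᵢ≢i j fzero
                      (disjoint partU _ j Pₖx (equidecomp-1-univ Pⱼ∼U x)))

theorem3p4 : (n r : ℕ) → 2 ≤ n → (G : Group 0ℓ 0ℓ) → (Ω : Set) → (A : Action G Ω)
    → Ω → Paradoxical A n r U → 2 * n ≤ r
theorem3p4 n@(suc (suc _)) r (s≤s (s≤s z≤n)) G Ω A ω (Ps , rs , partU , Ps∼U , Σrs≡r) =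
  subst₂ _≤_ (*-comm n 2) Σrs≡r
    (sum-tabulate-≥ n 2 rs (paradoxical-piece-count-≥2 A ω partU Ps∼U))
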